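{- Let $G$ be a graph of order $n$. If the vertex set $V$ of $G$ can be partitioned into $k\geq 1$ vertex-disjoint cliques of $\overline{G^2}$ such that at least $k-1$ of these cliques have order at least $3$, then $\lambda(M(G))=n+1$.
   Context: $G^2$ is the square of $G$: same vertex set, $xy$ an edge iff $1\le d_G(x,y)\le 2$; $\overline{G^2}$ is its complement, so $xy\in E(\overline{G^2})$ iff $d_G(x,y)\geq 3$ (including infinite distance). An $L(2,1)$-labeling of $G$ is a map $f:V\to\{0,1,2,\dots\}$ with $|f(x)-f(y)|\ge 2$ if $d_G(x,y)=1$ and $|f(x)-f(y)|\ge1$ if $d_G(x,y)=2$; $\lambda(G)$ is the minimum over such $f$ of the largest label. For $V=\{v_1,\dots,v_n\}$, $M(G)$ has vertex set $V\cup\{v_1',\dots,v_n'\}\cup\{u\}$ and edge set $E\cup\{v_iv_j' : v_iv_j\in E\}\cup\{v_i'u: 1\le i\le n\}$. -}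

module Defs where

open import Data.Nat using (ℕ; _≤_)
open import Data.Fin using (Fin)
open import Data.Fin.Subset using (Subset; ∣_∣)
open import Data.Vec using (tabulate)
open import Data.Product using (Σ; ∃; _×_)
open import Data.Unit using (⊤)
open import Relation.Nullary using (¬_; Dec; does)
open import Relation.Binary.PropositionalEquality using (_≡_; _≢_)
open import Function.Definitions using (Surjective)
import Data.Fin as F

record Graph (V : Set) : Set₁ where
  field
    Adj    : V → V → Set
    sym    : ∀ {x y} → Adj x y → Adj y x
    irrefl : ∀ {x} → ¬ Adj x x
    adj?   : ∀ x y → Dec (Adj x y)
open Graph public

Dist1 : ∀ {V} → Graph V → V → V → Set
Dist1 G x y = Adj G x y

Dist2 : ∀ {V} → Graph V → V → V → Set
Dist2 G x y = x ≢ y × ¬ Adj G x y × ∃ λ z → Adj G x z × Adj G z y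

-- d_G(x,y) ≥ 3 (including infinite distance): x ≠ y, neither
-- at distance 1 nor at distance 2.  This is adjacency in the complement of G².
Dist≥3 : ∀ {V} → Graph V → V → V → Set
Dist≥3 G x y = x ≢ y × ¬ Adj G x y × ¬ (∃ λ z → Adj G x z × Adj G z y)

IsL21 : ∀ {V} → Graph V → (V → ℕ) → Set
IsL21 G f =
  (∀ x y → Dist1 G x y → 2 ≤ ∣ f x - f y ∣') ×
  (∀ x y → Dist2 G x y → 1 ≤ ∣ f x - f y ∣')
  where
  open import Data.Nat using () renaming (∣_-_∣ to ∣_-_∣')

-- λ(G) ≡ m : some L(2,1)-labeling has all labels ≤ m, and every
-- L(2,1)-labeling has some label ≥ m (i.e. the minimum over labelings of the
-- largest label is m).
IsLambda : ∀ {V} → Graph V → ℕ → Set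
IsLambda {V} G m =
  (∃ λ (f : V → ℕ) → IsL21 G f × (∀ v → f v ≤ m)) ×
  (∀ (f : V → ℕ) → IsL21 G f → ∃ λ v → m ≤ f v)

data MV (n : ℕ) : Set where
  orig : Fin n → MV n
  copy : Fin n → MV n
  hub  : MV n

data MAdj {n : ℕ} (G : Graph (Fin n)) : MV n → MV n → Set where
  oo : ∀ {i j} → Adj G i j → MAdj G (orig i) (orig j)
  oc : ∀ {i j} → Adj G i j → MAdj G (orig i) (copy j)
  co : ∀ {i j} → Adj G i j → MAdj G (copy j) (orig i)
  cu : ∀ {i} → MAdj G (copy i) hub
  uc : ∀ {i} → MAdj G hub (copy i)

private
  open import Data.Empty using (⊥-elim)
  open import Relation.Nullary using (yes; no)
  open import Relation.Binary.PropositionalEquality using (refl)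

  msym : ∀ {n} {G : Graph (Fin n)} {x y} → MAdj G x y → MAdj G y x
  msym {G = G} (oo a) = oo (sym G a)
  msym (oc a) = co a
  msym (co a) = oc a
  msym cu = uc
  msym uc = cu

  mirr : ∀ {n} {G : Graph (Fin n)} {x} → ¬ MAdj G x x
  mirr {G = G} (oo a) = irrefl G a

  madj? : ∀ {n} (G : Graph (Fin n)) x y → Dec (MAdj G x y)
  madj? G (orig i) (orig j) with adj? G i j
  ... | yes a = yes (oo a)
  ... | no na = no λ { (oo a) → na a }
  madj? G (orig i) (copy j) with adj? G i j
  ... | yes a = yes (oc a)
  ... | no na = no λ { (oc a) → na a }
  madj? G (orig i) hub = no λ ()
  madj? G (copy j) (orig i) with adj? G i j
  ... | yes a = yes (co a)
  ... | no na = no λ { (co a) → na a }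
  madj? G (copy i) (copy j) = no λ ()
  madj? G (copy i) hub = yes cu
  madj? G hub (orig i) = no λ ()
  madj? G hub (copy i) = yes uc
  madj? G hub hub = no λ ()

M : ∀ {n} → Graph (Fin n) → Graph (MV n)
M G = record { Adj = MAdj G ; sym = msym ; irrefl = mirr ; adj? = madj? G }

part : ∀ {n k} → (Fin n → Fin k) → Fin k → Subset n
part p i = tabulate λ x → does (p x F.≟ i)

IsCliquePartition : ∀ {n k} → Graph (Fin n) → (Fin n → Fin k) → Set
IsCliquePartition G p =
  Surjective _≡_ _≡_ p ×
  (∀ x y → x ≢ y → p x ≡ p y → Dist≥3 G x y)

module Submission where

-- Lower bound: the hub and the n copies are pairwise at distance at most 2 and the hub is
-- adjacent to every copy, so the copies need n distinct labels, each at distance at least 2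
-- from the hub's label c; if all labels are at most n, deleting the two values c ± 1 maps
-- them injectively into {0, …, n - 2}.
--
-- Upper bound: order V clique by clique, the exceptional clique first, and label the hub 0 and
-- the copy of the vertex of rank r with 2 + r.  Distinct vertices of one clique of the
-- complement of G² have no common neighbour, so the originals of the exceptional clique can
-- all take 1 and the originals of any other clique can share the copy label of one of its
-- vertices, mid, except mid itself, which takes the copy label of a third vertex, spare.
-- Inside a clique put first a vertex not adjacent to the mid of the previous clique and mid
-- second; then each original label is 2 away from the copy labels of all its neighbours.

open import Defs hiding (sym)

open import Data.Nat using (ℕ; zero; suc; _+_; _*_; _∸_; _≤_; _<_; z≤n; s≤s; s≤s⁻¹; z<s; s<s; ∣_-_∣; _<?_; _≤?_)
import Data.Nat as ℕ
open import Data.Nat.Properties hiding (_≟_)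
open import Data.Fin using (Fin; zero; toℕ; fromℕ<; _≟_)
import Data.Fin.Properties as Finₚ
open import Data.Fin.Permutation.Components using (transpose; transpose-inverse)
open import Data.Fin.Subset using (Subset; ∣_∣; _∈_; _⊆_; _∪_; ⁅_⁆; inside; outside)
open import Data.Fin.Subset.Properties
  using (_∈?_; p⊆q⇒∣p∣≤∣q∣; p⊂q⇒∣p∣<∣q∣; ∣⁅x⁆∣≡1; ∣⊤∣≡n; ∈⊤; x∈p∪q⁺; x∈⁅x⁆)
open import Data.Vec using (_∷_; []; tabulate)
open import Data.Vec.Properties using ([]=⇒lookup; lookup⇒[]=; lookup∘tabulate)
open import Data.Product using (∃; _×_; _,_; proj₁; proj₂)
open import Data.Sum using (_⊎_; inj₁; inj₂; swap)
open import Data.Empty using (⊥; ⊥-elim)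
open import Function using (_∘_)
open import Relation.Nullary using (¬_; Dec; yes; no; does)
open import Relation.Nullary.Decidable using (_×-dec_; ¬?; dec-true)
open import Relation.Unary using (Pred; Decidable)
open import Relation.Binary using (tri<; tri≈; tri>)
open import Relation.Binary.PropositionalEquality

module _ {n ℓ} {P : Pred (Fin n) ℓ} (P? : Decidable P) where

  members : Subset n
  members = tabulate (does ∘ P?)

  ∈-members⁺ : ∀ {x} → P x → x ∈ members
  ∈-members⁺ {x} px = lookup⇒[]= x members (trans (lookup∘tabulate (does ∘ P?) x) (dec-true (P? x) px))

  ∈-members⁻ : ∀ {x} → x ∈ members → P x
  ∈-members⁻ {x} x∈ = holds (trans (sym (lookup∘tabulate (does ∘ P?) x)) ([]=⇒lookup x∈))
    where
    holds : does (P? x) ≡ inside → P x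
    holds eq with P? x
    ... | yes px = px

  opaque
    pick : Fin n → Fin n
    pick default with Finₚ.any? P?
    ... | yes (x , _) = x
    ... | no _        = default

    pick-satisfies : ∀ default → ∃ P → P (pick default)
    pick-satisfies default ∃P with Finₚ.any? P?
    ... | yes (_ , px) = px
    ... | no ∄P        = ⊥-elim (∄P ∃P)

∣p∪q∣≤∣p∣+∣q∣ : ∀ {n} (p q : Subset n) → ∣ p ∪ q ∣ ≤ ∣ p ∣ + ∣ q ∣
∣p∪q∣≤∣p∣+∣q∣ []            []            = z≤n
∣p∪q∣≤∣p∣+∣q∣ (outside ∷ p) (outside ∷ q) = ∣p∪q∣≤∣p∣+∣q∣ p q
∣p∪q∣≤∣p∣+∣q∣ (outside ∷ p) (inside ∷ q)  =
  ≤-trans (s≤s (∣p∪q∣≤∣p∣+∣q∣ p q)) (≤-reflexive (sym (+-suc ∣ p ∣ ∣ q ∣)))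
∣p∪q∣≤∣p∣+∣q∣ (inside ∷ p)  (outside ∷ q) = s≤s (∣p∪q∣≤∣p∣+∣q∣ p q)
∣p∪q∣≤∣p∣+∣q∣ (inside ∷ p)  (inside ∷ q)  =
  s≤s (≤-trans (∣p∪q∣≤∣p∣+∣q∣ p q) (+-monoʳ-≤ ∣ p ∣ (n≤1+n ∣ q ∣)))

3≤∣p∣⇒∃∈-avoiding : ∀ {n} {p : Subset n} → 3 ≤ ∣ p ∣ → ∀ y z → ∃ λ x → x ∈ p × x ≢ y × x ≢ z
3≤∣p∣⇒∃∈-avoiding {n} {p} 3≤∣p∣ y z with Finₚ.any? (λ x → (x ∈? p) ×-dec ¬? (x ≟ y) ×-dec ¬? (x ≟ z))
... | yes found = found
... | no none   = ⊥-elim (<-irrefl refl (≤-trans 3≤∣p∣ ∣p∣≤2))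
  where
  p⊆⁅y⁆∪⁅z⁆ : p ⊆ ⁅ y ⁆ ∪ ⁅ z ⁆
  p⊆⁅y⁆∪⁅z⁆ {x} x∈p with x ≟ y | x ≟ z
  ... | yes refl | _        = x∈p∪q⁺ (inj₁ (x∈⁅x⁆ x))
  ... | no _     | yes refl = x∈p∪q⁺ (inj₂ (x∈⁅x⁆ x))
  ... | no x≢y   | no x≢z   = ⊥-elim (none (x , x∈p , x≢y , x≢z))

  ∣p∣≤2 : ∣ p ∣ ≤ 2
  ∣p∣≤2 = begin
    ∣ p ∣                 ≤⟨ p⊆q⇒∣p∣≤∣q∣ p⊆⁅y⁆∪⁅z⁆ ⟩
    ∣ ⁅ y ⁆ ∪ ⁅ z ⁆ ∣     ≤⟨ ∣p∪q∣≤∣p∣+∣q∣ ⁅ y ⁆ ⁅ z ⁆ ⟩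
    ∣ ⁅ y ⁆ ∣ + ∣ ⁅ z ⁆ ∣ ≡⟨ cong₂ _+_ (∣⁅x⁆∣≡1 y) (∣⁅x⁆∣≡1 z) ⟩
    2                     ∎
    where open ≤-Reasoning

module Rank {n} (key : Fin n → ℕ) where

  below : Fin n → Subset n
  below x = members (λ y → key y <? key x)

  rank : Fin n → ℕ
  rank x = ∣ below x ∣

  ∉below : ∀ x → ¬ x ∈ below x
  ∉below x x∈ = <-irrefl refl (∈-members⁻ (λ y → key y <? key x) x∈)

  rank-mono : ∀ {x y} → key x < key y → rank x < rank y
  rank-mono {x} {y} kx<ky =
    p⊂q⇒∣p∣<∣q∣ (below-x⊆below-y , x , ∈-members⁺ (λ z → key z <? key y) kx<ky , ∉below x)
    where
    below-x⊆below-y : below x ⊆ below y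
    below-x⊆below-y z∈ =
      ∈-members⁺ (λ z → key z <? key y) (<-trans (∈-members⁻ (λ z → key z <? key x) z∈) kx<ky)

  rank<n : ∀ x → rank x < n
  rank<n x = subst (rank x <_) (∣⊤∣≡n n) (p⊂q⇒∣p∣<∣q∣ ((λ _ → ∈⊤) , x , ∈⊤ , ∉below x))

  rank-injective : (∀ {x y} → key x ≡ key y → x ≡ y) → ∀ {x y} → rank x ≡ rank y → x ≡ y
  rank-injective key-injective {x} {y} eq with <-cmp (key x) (key y)
  ... | tri< kx<ky _ _ = ⊥-elim (<-irrefl eq (rank-mono kx<ky))
  ... | tri≈ _ kx≡ky _ = key-injective kx≡ky
  ... | tri> _ _ ky<kx = ⊥-elim (<-irrefl (sym eq) (rank-mono ky<kx))

TwoApart : ℕ → ℕ → Set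
TwoApart a c = 2 + a ≤ c ⊎ 2 + c ≤ a

TwoApart⇒2≤∣-∣ : ∀ {a c} → TwoApart a c → 2 ≤ ∣ a - c ∣
TwoApart⇒2≤∣-∣ {a} {c} (inj₁ 2+a≤c) = go a c 2+a≤c
  where
  go : ∀ a c → 2 + a ≤ c → 2 ≤ ∣ a - c ∣
  go zero    c       h       = h
  go (suc a) (suc c) (s≤s h) = go a c h
TwoApart⇒2≤∣-∣ {a} {c} (inj₂ 2+c≤a) = subst (2 ≤_) (∣-∣-comm c a) (TwoApart⇒2≤∣-∣ (inj₁ 2+c≤a))

2≤∣-∣⇒TwoApart : ∀ a c → 2 ≤ ∣ a - c ∣ → TwoApart a c
2≤∣-∣⇒TwoApart zero    c       h = inj₁ h
2≤∣-∣⇒TwoApart (suc a) zero    h = inj₂ h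
2≤∣-∣⇒TwoApart (suc a) (suc c) h with 2≤∣-∣⇒TwoApart a c h
... | inj₁ 2+a≤c = inj₁ (s≤s 2+a≤c)
... | inj₂ 2+c≤a = inj₂ (s≤s 2+c≤a)

TwoApart⇒≢ : ∀ {a c} → TwoApart a c → a ≢ c
TwoApart⇒≢ (inj₁ 2+a≤c) refl = <-irrefl refl (≤-trans (n≤1+n _) 2+a≤c)
TwoApart⇒≢ (inj₂ 2+c≤a) refl = <-irrefl refl (≤-trans (n≤1+n _) 2+c≤a)

≢⇒1≤∣-∣ : ∀ {a c} → a ≢ c → 1 ≤ ∣ a - c ∣
≢⇒1≤∣-∣ a≢c = n≢0⇒n>0 (a≢c ∘ ∣m-n∣≡0⇒m≡n)

1≤∣-∣⇒≢ : ∀ {a c} → 1 ≤ ∣ a - c ∣ → a ≢ c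
1≤∣-∣⇒≢ {a} 1≤∣a-a∣ refl = <-irrefl (sym (∣n-n∣≡0 a)) 1≤∣a-a∣

lex-< : ∀ {N a b c d} → a < N → b < d → a + b * N < c + d * N
lex-< {N} {a} {b} {c} {d} a<N b<d = begin-strict
  a + b * N  <⟨ +-monoˡ-< (b * N) a<N ⟩
  N + b * N  ≤⟨ *-monoˡ-≤ N b<d ⟩
  d * N      ≤⟨ m≤n+m (d * N) c ⟩
  c + d * N  ∎
  where open ≤-Reasoning

squeeze : ∀ {a c} → TwoApart a c → ℕ
squeeze {a} (inj₁ _) = a
squeeze {a} (inj₂ _) = a ∸ 2

squeeze-< : ∀ {m a c} → a ≤ suc m → c ≤ suc m → (apart : TwoApart a c) → squeeze apart < m
squeeze-< a≤1+m c≤1+m (inj₁ 2+a≤c)           = s≤s⁻¹ (≤-trans 2+a≤c c≤1+m)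
squeeze-< a≤1+m c≤1+m (inj₂ (s≤s (s≤s _))) = s≤s⁻¹ a≤1+m

squeeze-injective : ∀ {a b c} (a-apart : TwoApart a c) (b-apart : TwoApart b c) →
                    squeeze a-apart ≡ squeeze b-apart → a ≡ b
squeeze-injective (inj₁ _)                 (inj₁ _)                 eq = eq
squeeze-injective (inj₂ (s≤s (s≤s _)))     (inj₂ (s≤s (s≤s _)))     eq = cong (2 +_) eq
squeeze-injective (inj₁ 2+a≤c)             (inj₂ (s≤s (s≤s c≤b)))   refl =
  ⊥-elim (<-irrefl refl (≤-trans (n≤1+n _) (≤-trans 2+a≤c c≤b)))
squeeze-injective (inj₂ (s≤s (s≤s c≤a)))   (inj₁ 2+b≤c)             refl =
  ⊥-elim (<-irrefl refl (≤-trans (n≤1+n _) (≤-trans 2+b≤c c≤a)))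

module LowerBound {m} (G : Graph (Fin (suc m))) (f : MV (suc m) → ℕ) (f-L21 : IsL21 (M G) f) where

  copies-at-distance-2 : ∀ {i j} → i ≢ j → Dist2 (M G) (copy i) (copy j)
  copies-at-distance-2 i≢j = (λ { refl → i≢j refl }) , (λ ()) , hub , cu , uc

  copy-apart-from-hub : ∀ i → TwoApart (f (copy i)) (f hub)
  copy-apart-from-hub i = 2≤∣-∣⇒TwoApart _ _ (proj₁ f-L21 (copy i) hub cu)

  labels-not-all-small : f hub ≤ suc m → ¬ (∀ i → f (copy i) ≤ suc m)
  labels-not-all-small hub≤ copies≤ with Finₚ.pigeonhole ≤-refl squeezed
    where
    squeezed : Fin (suc m) → Fin m
    squeezed i = fromℕ< (squeeze-< (copies≤ i) hub≤ (copy-apart-from-hub i))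
  ... | i , j , i<j , eq =
    1≤∣-∣⇒≢ (proj₂ f-L21 _ _ (copies-at-distance-2 (Finₚ.<⇒≢ i<j)))
      (squeeze-injective (copy-apart-from-hub i) (copy-apart-from-hub j) (Finₚ.fromℕ<-injective _ _ _ _ eq))

  some-label-large : ∃ λ v → suc (suc m) ≤ f v
  some-label-large with f hub ≤? suc m
  ... | no hub≰ = hub , ≰⇒> hub≰
  ... | yes hub≤ with Finₚ.any? (λ i → suc (suc m) ≤? f (copy i))
  ...   | yes (i , large) = copy i , large
  ...   | no none         = ⊥-elim (labels-not-all-small hub≤ (λ i → ≮⇒≥ (λ large → none (i , large))))

lower-bound : ∀ {n} (G : Graph (Fin n)) → Fin n → ∀ f → IsL21 (M G) f → ∃ λ v → suc n ≤ f v
lower-bound {suc m} G _ f f-L21 = LowerBound.some-label-large G f f-L21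

module Construction {n k} (G : Graph (Fin n)) (v₀ : Fin n) (block : Fin n → ℕ)
  (block<k : ∀ x → block x < k)
  (same-block⇒far : ∀ {x y} → x ≢ y → block x ≡ block y → Dist≥3 G x y)
  (regular-blocks-large : ∀ {t} → 0 < t → t < k → 3 ≤ ∣ members (λ x → block x ℕ.≟ t) ∣)
  where

  Regular : ℕ → Set
  Regular t = 0 < t × t < k

  block-regular : ∀ {x} → 0 < block x → Regular (block x)
  block-regular {x} 0<bx = 0<bx , block<k x

  in-block? : ∀ t x → Dec (block x ≡ t)
  in-block? t x = block x ℕ.≟ t

  ∃-in-block-avoiding : ∀ {t} → Regular t → ∀ y z → ∃ λ x → block x ≡ t × x ≢ y × x ≢ z
  ∃-in-block-avoiding {t} (0<t , t<k) y z with 3≤∣p∣⇒∃∈-avoiding (regular-blocks-large 0<t t<k) y z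
  ... | x , x∈ , x≢y , x≢z = x , ∈-members⁻ (in-block? t) x∈ , x≢y , x≢z

  common-neighbour⇒≢-block : ∀ {x w y} → x ≢ y → Adj G x w → Adj G w y → block x ≢ block y
  common-neighbour⇒≢-block x≢y x~w w~y same = proj₂ (proj₂ (same-block⇒far x≢y same)) (_ , x~w , w~y)

  adjacent⇒≢-block : ∀ {x y} → Adj G x y → block x ≢ block y
  adjacent⇒≢-block {x} x~y same = proj₁ (proj₂ (same-block⇒far x≢y same)) x~y
    where
    x≢y : x ≢ _
    x≢y refl = Graph.irrefl G x~y

  distance≤2⇒≡⊎≢-block : ∀ {x w y} → Adj G x w → Adj G w y → x ≡ y ⊎ block x ≢ block y
  distance≤2⇒≡⊎≢-block {x} {y = y} x~w w~y with x ≟ y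
  ... | yes x≡y = inj₁ x≡y
  ... | no x≢y  = inj₂ (common-neighbour⇒≢-block x≢y x~w w~y)

  mid : ℕ → Fin n
  mid t = pick (in-block? t) v₀

  head-candidate? : ∀ t x → Dec (block x ≡ t × x ≢ mid t × ¬ Adj G (mid (t ∸ 1)) x)
  head-candidate? t x = in-block? t x ×-dec ¬? (x ≟ mid t) ×-dec ¬? (adj? G (mid (t ∸ 1)) x)

  head : ℕ → Fin n
  head t = pick (head-candidate? t) v₀

  spare-candidate? : ∀ t x → Dec (block x ≡ t × x ≢ head t × x ≢ mid t)
  spare-candidate? t x = in-block? t x ×-dec ¬? (x ≟ head t) ×-dec ¬? (x ≟ mid t)

  spare : ℕ → Fin n
  spare t = pick (spare-candidate? t) v₀

  module _ {t} (reg : Regular t) where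

    block-mid : block (mid t) ≡ t
    block-mid = pick-satisfies (in-block? t) v₀ (let x , bx≡t , _ = ∃-in-block-avoiding reg v₀ v₀ in x , bx≡t)

    private
      -- A vertex v has at most one neighbour in a block, so of two vertices of block t
      -- other than mid t one is not adjacent to v.
      head-spec : block (head t) ≡ t × head t ≢ mid t × ¬ Adj G (mid (t ∸ 1)) (head t)
      head-spec = pick-satisfies (head-candidate? t) v₀ candidate
        where
        v = mid (t ∸ 1)
        candidate : ∃ λ x → block x ≡ t × x ≢ mid t × ¬ Adj G v x
        candidate with ∃-in-block-avoiding reg (mid t) (mid t)
        ... | x , bx≡t , x≢mid , _ with adj? G v x
        ...   | no v≁x = x , bx≡t , x≢mid , v≁x
        ...   | yes v~x with ∃-in-block-avoiding reg (mid t) x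
        ...     | y , by≡t , y≢mid , y≢x with adj? G v y
        ...       | no v≁y  = y , by≡t , y≢mid , v≁y
        ...       | yes v~y = ⊥-elim (common-neighbour⇒≢-block (y≢x ∘ sym) (Graph.sym G v~x) v~y
                                        (trans bx≡t (sym by≡t)))

      spare-spec : block (spare t) ≡ t × spare t ≢ head t × spare t ≢ mid t
      spare-spec = pick-satisfies (spare-candidate? t) v₀ (∃-in-block-avoiding reg (head t) (mid t))

    block-head : block (head t) ≡ t
    block-head = proj₁ head-spec

    head≢mid : head t ≢ mid t
    head≢mid = proj₁ (proj₂ head-spec)

    head-≁-previous-mid : ¬ Adj G (mid (t ∸ 1)) (head t)
    head-≁-previous-mid = proj₂ (proj₂ head-spec)

    block-spare : block (spare t) ≡ t
    block-spare = proj₁ spare-spec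

    spare≢head : spare t ≢ head t
    spare≢head = proj₁ (proj₂ spare-spec)

    spare≢mid : spare t ≢ mid t
    spare≢mid = proj₂ (proj₂ spare-spec)

  data Position (x : Fin n) : Set where
    leader : x ≡ head (block x) → Position x
    middle : x ≢ head (block x) → x ≡ mid (block x) → Position x
    other  : x ≢ head (block x) → x ≢ mid (block x) → Position x

  position : ∀ x → Position x
  position x with x ≟ head (block x) | x ≟ mid (block x)
  ... | yes x≡head | _         = leader x≡head
  ... | no x≢head  | yes x≡mid = middle x≢head x≡mid
  ... | no x≢head  | no x≢mid  = other x≢head x≢mid

  offset : Fin n → ℕ
  offset x with position x
  ... | leader _   = 0
  ... | middle _ _ = 1
  ... | other _ _  = 2 + toℕ x

  offset<2+n : ∀ x → offset x < 2 + n
  offset<2+n x with position x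
  ... | leader _   = z<s
  ... | middle _ _ = s<s z<s
  ... | other _ _  = s<s (s<s (Finₚ.toℕ<n x))

  offset-injective : ∀ {x y} → block x ≡ block y → offset x ≡ offset y → x ≡ y
  offset-injective {x} {y} same eq with position x | position y
  ... | leader x≡head  | leader y≡head  = trans x≡head (trans (cong head same) (sym y≡head))
  ... | middle _ x≡mid | middle _ y≡mid = trans x≡mid (trans (cong mid same) (sym y≡mid))
  ... | other _ _      | other _ _      = Finₚ.toℕ-injective (suc-injective (suc-injective eq))
  ... | leader _       | middle _ _     with () ← eq
  ... | leader _       | other _ _      with () ← eq
  ... | middle _ _     | leader _       with () ← eq
  ... | middle _ _     | other _ _      with () ← eq
  ... | other _ _      | leader _       with () ← eq
  ... | other _ _      | middle _ _     with () ← eq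

  1≤offset : ∀ {x} → x ≢ head (block x) → 1 ≤ offset x
  1≤offset {x} x≢head with position x
  ... | leader x≡head = ⊥-elim (x≢head x≡head)
  ... | middle _ _    = s≤s z≤n
  ... | other _ _     = s≤s z≤n

  key : Fin n → ℕ
  key x = offset x + block x * (2 + n)

  key-injective : ∀ {x y} → key x ≡ key y → x ≡ y
  key-injective {x} {y} eq with <-cmp (block x) (block y)
  ... | tri< bx<by _ _ = ⊥-elim (<-irrefl eq (lex-< (offset<2+n x) bx<by))
  ... | tri> _ _ by<bx = ⊥-elim (<-irrefl (sym eq) (lex-< (offset<2+n y) by<bx))
  ... | tri≈ _ same _  = offset-injective same (+-cancelʳ-≡ (block x * (2 + n)) _ _ eq′)
    where
    eq′ : offset x + block x * (2 + n) ≡ offset y + block x * (2 + n)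
    eq′ = trans eq (cong (λ b → offset y + b * (2 + n)) (sym same))

  open Rank key

  rank-block : ∀ {x y} → block x < block y → rank x < rank y
  rank-block {x} {y} bx<by = rank-mono {x} {y} (lex-< (offset<2+n x) bx<by)

  rank-offset : ∀ {x y} → block x ≡ block y → offset x < offset y → rank x < rank y
  rank-offset {x} {y} same ox<oy =
    rank-mono {x} {y} (subst (λ b → key x < offset y + b * (2 + n)) same (+-monoˡ-< (block x * (2 + n)) ox<oy))

  module _ {t} (reg : Regular t) where

    offset-head : offset (head t) ≡ 0
    offset-head with position (head t)
    ... | leader _       = refl
    ... | middle ≢head _ = ⊥-elim (≢head (cong head (sym (block-head reg))))
    ... | other ≢head _  = ⊥-elim (≢head (cong head (sym (block-head reg))))

    offset-mid : offset (mid t) ≡ 1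
    offset-mid with position (mid t)
    ... | leader ≡head = ⊥-elim (head≢mid reg (sym (trans ≡head (cong head (block-mid reg)))))
    ... | middle _ _   = refl
    ... | other _ ≢mid = ⊥-elim (≢mid (cong mid (sym (block-mid reg))))

    2≤offset-spare : 2 ≤ offset (spare t)
    2≤offset-spare with position (spare t)
    ... | leader ≡head  = ⊥-elim (spare≢head reg (trans ≡head (cong head (block-spare reg))))
    ... | middle _ ≡mid = ⊥-elim (spare≢mid reg (trans ≡mid (cong mid (block-spare reg))))
    ... | other _ _     = s≤s (s≤s z≤n)

    rank-head< : ∀ {y} → t ≤ block y → y ≢ head t → rank (head t) < rank y
    rank-head< {y} t≤by y≢head with block y ℕ.≟ t
    ... | yes by≡t = rank-offset (trans (block-head reg) (sym by≡t))
                       (subst (_< offset y) (sym offset-head) (1≤offset y≢head′))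
      where
      y≢head′ : y ≢ head (block y)
      y≢head′ y≡ = y≢head (trans y≡ (cong head by≡t))
    ... | no by≢t  = rank-block (subst (_< block y) (sym (block-head reg)) (≤∧≢⇒< t≤by (by≢t ∘ sym)))

    rank-mid<spare : rank (mid t) < rank (spare t)
    rank-mid<spare = rank-offset (trans (block-mid reg) (sym (block-spare reg)))
                       (subst (_< offset (spare t)) (sym offset-mid) 2≤offset-spare)

  partner : Fin n → Fin n
  partner x with x ≟ mid (block x)
  ... | yes _ = spare (block x)
  ... | no _  = mid (block x)

  module _ {x} (reg : Regular (block x)) where

    block-partner : block (partner x) ≡ block x
    block-partner with x ≟ mid (block x)
    ... | yes _ = block-spare reg
    ... | no _  = block-mid reg

    partner≢self : partner x ≢ x
    partner≢self with x ≟ mid (block x)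
    ... | yes x≡mid = λ spare≡x → spare≢mid reg (trans spare≡x x≡mid)
    ... | no x≢mid  = x≢mid ∘ sym

    rank-head<partner : rank (head (block x)) < rank (partner x)
    rank-head<partner = rank-head< reg (≤-reflexive (sym block-partner)) partner≢head
      where
      partner≢head : partner x ≢ head (block x)
      partner≢head with x ≟ mid (block x)
      ... | yes _ = spare≢head reg
      ... | no _  = head≢mid reg ∘ sym

  rank-before-partner : ∀ {z x} → block z < block x → 2 + rank z ≤ rank (partner x)
  rank-before-partner {z} {x} bz<bx = ≤-trans (s≤s z<head) (rank-head<partner reg)
    where
    reg : Regular (block x)
    reg = block-regular (≤-trans (s≤s z≤n) bz<bx)
    z<head : rank z < rank (head (block x))
    z<head = rank-block (subst (block z <_) (sym (block-head reg)) bz<bx)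

  -- For x = mid t the partner is spare t, and head (t + 1) lies strictly between spare t and
  -- any later neighbour y of x, since it is not adjacent to mid t.
  rank-after-partner : ∀ {x y} → 0 < block x → block x < block y → Adj G x y → 2 + rank (partner x) ≤ rank y
  rank-after-partner {x} {y} 0<bx bx<by x~y with x ≟ mid (block x)
  ... | no _ = ≤-trans (s≤s (rank-mid<spare reg)) (rank-block (subst (_< block y) (sym (block-spare reg)) bx<by))
    where reg = block-regular 0<bx
  ... | yes x≡mid = ≤-trans (s≤s spare<next-head) (rank-head< next-reg bx<by y≢next-head)
    where
    reg = block-regular 0<bx
    next-reg : Regular (suc (block x))
    next-reg = z<s , ≤-trans (s≤s bx<by) (block<k y)
    spare<next-head : rank (spare (block x)) < rank (head (suc (block x)))
    spare<next-head = rank-block (subst₂ _<_ (sym (block-spare reg)) (sym (block-head next-reg)) ≤-refl)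
    y≢next-head : y ≢ head (suc (block x))
    y≢next-head y≡head = head-≁-previous-mid next-reg (subst₂ (Adj G) x≡mid y≡head x~y)

  origLabel : Fin n → ℕ
  origLabel x with block x
  ... | zero  = 1
  ... | suc _ = 2 + rank (partner x)

  data OrigLabel (x : Fin n) : ℕ → Set where
    exceptional : block x ≡ 0 → OrigLabel x 1
    regular     : 0 < block x → OrigLabel x (2 + rank (partner x))

  origLabel-view : ∀ x → OrigLabel x (origLabel x)
  origLabel-view x with block x in bx≡
  ... | zero  = exceptional bx≡
  ... | suc _ = regular (subst (0 <_) (sym bx≡) z<s)

  origLabel-bounds : ∀ {x ℓ} → OrigLabel x ℓ → 1 ≤ ℓ × ℓ ≤ suc n
  origLabel-bounds (exceptional _)       = ≤-refl , s≤s z≤n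
  origLabel-bounds {x} (regular _) = s≤s z≤n , s≤s (rank<n (partner x))

  origLabel-increasing : ∀ {x y ℓ ℓ′} → block x < block y → OrigLabel x ℓ → OrigLabel y ℓ′ → 2 + ℓ ≤ ℓ′
  origLabel-increasing {x} bx<by _ (exceptional by≡0) = ⊥-elim (n≮0 (subst (block x <_) by≡0 bx<by))
  origLabel-increasing {x} {y} bx<by (exceptional _) (regular _) =
    s≤s (s≤s (≤-trans (s≤s z≤n) (rank-before-partner {x} {y} bx<by)))
  origLabel-increasing {x} {y} bx<by (regular 0<bx) (regular _) =
    +-monoʳ-≤ 2 (rank-before-partner {partner x} {y} bpx<by)
    where
    bpx<by : block (partner x) < block y
    bpx<by = subst (_< block y) (sym (block-partner (block-regular 0<bx))) bx<by

  origLabels-apart : ∀ {x y ℓ ℓ′} → block x ≢ block y → OrigLabel x ℓ → OrigLabel y ℓ′ → TwoApart ℓ ℓ′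
  origLabels-apart {x} {y} bx≢by lx ly with <-cmp (block x) (block y)
  ... | tri< bx<by _ _ = inj₁ (origLabel-increasing bx<by lx ly)
  ... | tri≈ _ bx≡by _ = ⊥-elim (bx≢by bx≡by)
  ... | tri> _ _ by<bx = inj₂ (origLabel-increasing by<bx ly lx)

  origLabel-apart-from-neighbour-copy : ∀ {x y ℓ} → Adj G x y → OrigLabel x ℓ → TwoApart ℓ (2 + rank y)
  origLabel-apart-from-neighbour-copy {x} {y} x~y lx with <-cmp (block x) (block y) | lx
  ... | tri< bx<by _ _ | exceptional _    = inj₁ (s≤s (s≤s (≤-trans (s≤s z≤n) (rank-block bx<by))))
  ... | tri< bx<by _ _ | regular 0<bx     = inj₁ (+-monoʳ-≤ 2 (rank-after-partner 0<bx bx<by x~y))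
  ... | tri≈ _ bx≡by _ | _                = ⊥-elim (adjacent⇒≢-block x~y bx≡by)
  ... | tri> _ _ by<bx | exceptional bx≡0 = ⊥-elim (n≮0 (subst (block y <_) bx≡0 by<bx))
  ... | tri> _ _ by<bx | regular _        = inj₂ (+-monoʳ-≤ 2 (rank-before-partner {y} {x} by<bx))

  origLabel≢copyLabel : ∀ {x y ℓ} → x ≡ y ⊎ block x ≢ block y → OrigLabel x ℓ → ℓ ≢ 2 + rank y
  origLabel≢copyLabel _ (exceptional _) ()
  origLabel≢copyLabel {x} {y} x≡y⊎bx≢by (regular 0<bx) eq = contradiction x≡y⊎bx≢by
    where
    reg = block-regular 0<bx
    partner≡y : partner x ≡ y
    partner≡y = rank-injective key-injective (suc-injective (suc-injective eq))
    contradiction : x ≡ y ⊎ block x ≢ block y → ⊥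
    contradiction (inj₁ x≡y)   = partner≢self reg (trans partner≡y (sym x≡y))
    contradiction (inj₂ bx≢by) = bx≢by (trans (sym (block-partner reg)) (cong block partner≡y))

  label : MV n → ℕ
  label (orig x) = origLabel x
  label (copy y) = 2 + rank y
  label hub      = 0

  label≤1+n : ∀ v → label v ≤ suc n
  label≤1+n (orig x) = proj₂ (origLabel-bounds (origLabel-view x))
  label≤1+n (copy y) = s≤s (rank<n y)
  label≤1+n hub      = z≤n

  label-distance-1 : ∀ u v → Adj (M G) u v → 2 ≤ ∣ label u - label v ∣
  label-distance-1 (orig x) (orig y) (oo x~y) =
    TwoApart⇒2≤∣-∣ (origLabels-apart (adjacent⇒≢-block x~y) (origLabel-view x) (origLabel-view y))
  label-distance-1 (orig x) (copy y) (oc x~y) =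
    TwoApart⇒2≤∣-∣ (origLabel-apart-from-neighbour-copy x~y (origLabel-view x))
  label-distance-1 (copy y) (orig x) (co x~y) =
    TwoApart⇒2≤∣-∣ (swap (origLabel-apart-from-neighbour-copy x~y (origLabel-view x)))
  label-distance-1 (copy y) hub cu = TwoApart⇒2≤∣-∣ (inj₂ (s≤s (s≤s z≤n)))
  label-distance-1 hub (copy y) uc = TwoApart⇒2≤∣-∣ (inj₁ (s≤s (s≤s z≤n)))

  label-distance-2 : ∀ u v → Dist2 (M G) u v → 1 ≤ ∣ label u - label v ∣
  label-distance-2 u v d2 = ≢⇒1≤∣-∣ (distinct u v d2)
    where
    orig-injective : ∀ {x y} → orig {n} x ≢ orig y → x ≢ y
    orig-injective ne refl = ne refl

    1≤origLabel : ∀ x → 1 ≤ origLabel x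
    1≤origLabel x = proj₁ (origLabel-bounds (origLabel-view x))

    distinct : ∀ u v → Dist2 (M G) u v → label u ≢ label v
    distinct (orig x) (orig y) (ne , _ , orig w , oo x~w , oo w~y) =
      TwoApart⇒≢ (origLabels-apart (common-neighbour⇒≢-block (orig-injective ne) x~w w~y)
                                   (origLabel-view x) (origLabel-view y))
    distinct (orig x) (orig y) (ne , _ , copy w , oc x~w , co y~w) =
      TwoApart⇒≢ (origLabels-apart (common-neighbour⇒≢-block (orig-injective ne) x~w (Graph.sym G y~w))
                                   (origLabel-view x) (origLabel-view y))
    distinct (orig x) (copy y) (_ , _ , orig w , oo x~w , oc w~y) =
      origLabel≢copyLabel (distance≤2⇒≡⊎≢-block x~w w~y) (origLabel-view x)
    distinct (copy y) (orig x) (_ , _ , orig w , co w~y , oo w~x) =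
      origLabel≢copyLabel (distance≤2⇒≡⊎≢-block (Graph.sym G w~x) w~y) (origLabel-view x) ∘ sym
    distinct (copy y) (copy z) (ne , _) eq =
      ne (cong copy (rank-injective key-injective (suc-injective (suc-injective eq))))
    distinct (orig x) hub _ eq = <-irrefl (sym eq) (1≤origLabel x)
    distinct hub (orig x) _ eq = <-irrefl eq (1≤origLabel x)
    distinct (copy y) hub (_ , ≁ , _) = ⊥-elim (≁ cu)
    distinct hub (copy y) (_ , ≁ , _) = ⊥-elim (≁ uc)
    distinct hub hub (ne , _) = ⊥-elim (ne refl)

  upper-bound : ∃ λ f → IsL21 (M G) f × (∀ v → f v ≤ suc n)
  upper-bound = label , (label-distance-1 , label-distance-2) , label≤1+n

module ExceptionalPartFirst {n k} (G : Graph (Fin n)) (p : Fin n → Fin (suc k)) (j : Fin (suc k))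
  (same-part⇒far : ∀ x y → x ≢ y → p x ≡ p y → Dist≥3 G x y)
  (large : ∀ i → i ≢ j → 3 ≤ ∣ part p i ∣)
  where

  σ : Fin (suc k) → Fin (suc k)
  σ = transpose j zero

  block : Fin n → ℕ
  block x = toℕ (σ (p x))

  block<1+k : ∀ x → block x < suc k
  block<1+k x = Finₚ.toℕ<n (σ (p x))

  same-block⇒far : ∀ {x y} → x ≢ y → block x ≡ block y → Dist≥3 G x y
  same-block⇒far {x} {y} x≢y eq = same-part⇒far x y x≢y (begin
    p x                         ≡⟨ transpose-inverse zero j ⟨
    transpose zero j (σ (p x))  ≡⟨ cong (transpose zero j) (Finₚ.toℕ-injective eq) ⟩
    transpose zero j (σ (p y))  ≡⟨ transpose-inverse zero j ⟩
    p y                         ∎)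
    where open ≡-Reasoning

  regular-blocks-large : ∀ {t} → 0 < t → t < suc k → 3 ≤ ∣ members (λ x → block x ℕ.≟ t) ∣
  regular-blocks-large {t} 0<t t<1+k = ≤-trans (large i′ i′≢j) (p⊆q⇒∣p∣≤∣q∣ part⊆block)
    where
    open ≡-Reasoning
    i = fromℕ< t<1+k
    i′ = transpose zero j i

    i′≢j : i′ ≢ j
    i′≢j i′≡j = <-irrefl (trans (cong toℕ (sym i≡0)) (Finₚ.toℕ-fromℕ< t<1+k)) 0<t
      where
      i≡0 : i ≡ zero
      i≡0 = begin
        i         ≡⟨ transpose-inverse j zero ⟨
        σ i′      ≡⟨ cong σ i′≡j ⟩
        σ j       ≡⟨ transpose-inverse j zero ⟩
        zero      ∎

    part⊆block : part p i′ ⊆ members (λ x → block x ℕ.≟ t)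
    part⊆block {x} x∈part = ∈-members⁺ (λ x → block x ℕ.≟ t) (begin
      toℕ (σ (p x))  ≡⟨ cong (toℕ ∘ σ) (∈-members⁻ (λ x → p x ≟ i′) x∈part) ⟩
      toℕ (σ i′)     ≡⟨ cong toℕ (transpose-inverse j zero) ⟩
      toℕ i          ≡⟨ Finₚ.toℕ-fromℕ< t<1+k ⟩
      t              ∎)

lemma3p1 : (n k : ℕ) → 1 ≤ k → (G : Graph (Fin n)) → (p : Fin n → Fin k)
    → IsCliquePartition G p
    → (∃ λ (j : Fin k) → ∀ (i : Fin k) → i ≢ j → 3 ≤ ∣ part p i ∣)
    → IsLambda (M G) (suc n)
lemma3p1 n (suc k) _ G p (p-surjective , same-part⇒far) (j , large) =
  upper-bound , lower-bound G v₀
  where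
  v₀ : Fin n
  v₀ = proj₁ (p-surjective zero)

  open ExceptionalPartFirst G p j same-part⇒far large
  open Construction G v₀ block block<1+k same-block⇒far regular-blocks-large
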